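{- Let $(S,\cdot)$ be a finite semigroup, $\alpha$ a complete linear ordering and $\sigma$ an additive labelling from $\alpha$ to $S$. Let $D$ be a regular $\mathcal{D}$-class of $S$ and $\beta\subseteq\alpha$ with $\sigma(\beta)\subseteq D$. Then there exists a ramseyan split of height at most $|D|$ of $(\beta,\sigma|_\beta)$.
   Context: An additive labelling from $\alpha$ to $S$ assigns to each pair $x<y$ in $\alpha$ an element $\sigma(x,y)\in S$ with $\sigma(x,y)\sigma(y,z)=\sigma(x,z)$ for $x<y<z$; $\sigma(\beta)=\{\sigma(x,y):x<y,\ x,y\in\beta\}$. Green's relations: $a\le_{\mathcal L}b$ iff $a=cb$, $a\le_{\mathcal R}b$ iff $a=bc$ for some $c\in S^1$ ($S$ with identity adjoined if needed); $\mathcal L,\mathcal R$ the associated equivalences; $a\,\mathcal D\,b$ iff $a\,\mathcal L\,c\,\mathcal R\,b$ for some $c$. An element $a$ is regular if $asa=a$ for some $s\in S$; a $\mathcal D$-class is regular if all its elements are regular. A split of height $N$ of $\beta$ is a map $s\colon\beta\to\{1,\dots,N\}$; $x,y$ with $s(x)=s(y)=k$ are $k$-neighbours if $s(z)\ge k$ for all $z\in\beta$ between them (inclusive); $s$ is ramseyan if for every $k$ and all $x<y$, $x'<y'$ that are all $k$-neighbours of one another, $\sigma(x,y)=\sigma(x',y')=\sigma(x,y)^2$. -}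

module Defs where

open import Level using (0ℓ)
open import Data.Nat using (ℕ)
open import Data.Fin using (Fin; _≟_)
open import Data.Fin.Properties using (any?)
open import Data.List using (List; length; filter; allFin)
open import Data.Product using (Σ; ∃; _×_; _,_)
open import Data.Sum using (_⊎_)
open import Relation.Nullary using (Dec; ¬_)
open import Relation.Nullary.Decidable using (_⊎-dec_; _×-dec_)
open import Relation.Binary.PropositionalEquality using (_≡_)
open import Algebra.Core using (Op₂)

-- Finite semigroups: carrier Fin n, multiplication _·_ (associativity is
-- assumed separately via IsSemigroup in the statement).

module Green {n : ℕ} (_·_ : Op₂ (Fin n)) where

  -- a ≤_L b  iff  a = c b for some c ∈ S¹
  _≤L_ : Fin n → Fin n → Set
  a ≤L b = (a ≡ b) ⊎ (∃ λ c → a ≡ c · b)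

  _≤R_ : Fin n → Fin n → Set
  a ≤R b = (a ≡ b) ⊎ (∃ λ c → a ≡ b · c)

  _𝓛_ : Fin n → Fin n → Set
  a 𝓛 b = (a ≤L b) × (b ≤L a)

  _𝓡_ : Fin n → Fin n → Set
  a 𝓡 b = (a ≤R b) × (b ≤R a)

  _𝓓_ : Fin n → Fin n → Set
  a 𝓓 b = ∃ λ c → (a 𝓛 c) × (c 𝓡 b)

  Regular : Fin n → Set
  Regular a = ∃ λ s → (a · s) · a ≡ a

  RegularDClass : Fin n → Set
  RegularDClass d = ∀ a → a 𝓓 d → Regular a

  ≤L? : ∀ a b → Dec (a ≤L b)
  ≤L? a b = (a ≟ b) ⊎-dec any? (λ c → a ≟ c · b)

  ≤R? : ∀ a b → Dec (a ≤R b)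
  ≤R? a b = (a ≟ b) ⊎-dec any? (λ c → a ≟ b · c)

  𝓓? : ∀ a b → Dec (a 𝓓 b)
  𝓓? a b = any? (λ c → ((≤L? a c ×-dec ≤L? c a)) ×-dec (≤R? c b ×-dec ≤R? b c))

  ∣Dclass∣ : Fin n → ℕ
  ∣Dclass∣ d = length (filter (λ a → 𝓓? a d) (allFin n))

module Order {A : Set} (_<_ : A → A → Set) where

  _≤_ : A → A → Set
  x ≤ y = (x < y) ⊎ (x ≡ y)

  IsUpperBound : (A → Set) → A → Set
  IsUpperBound X u = ∀ x → X x → x ≤ u

  IsLowerBound : (A → Set) → A → Set
  IsLowerBound X l = ∀ x → X x → l ≤ x

  Complete : Set₁
  Complete = (X : A → Set) →
    (∃ λ u → IsUpperBound X u × (∀ v → IsUpperBound X v → u ≤ v)) ×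
    (∃ λ l → IsLowerBound X l × (∀ m → IsLowerBound X m → m ≤ l))

  Between : A → A → A → Set
  Between x z y = ((x ≤ z) × (z ≤ y)) ⊎ ((y ≤ z) × (z ≤ x))

module Labelling {A : Set} (_<_ : A → A → Set) {n : ℕ} (_·_ : Op₂ (Fin n)) where

  open Order _<_

  -- σ is given on all pairs, only its values on x < y matter
  Additive : (A → A → Fin n) → Set
  Additive σ = ∀ x y z → x < y → y < z → σ x y · σ y z ≡ σ x z

  LabelsIn : (A → A → Fin n) → (β : A → Set) → (Fin n → Set) → Set
  LabelsIn σ β P = ∀ x y → β x → β y → x < y → P (σ x y)

  module _ (β : A → Set) {N : ℕ}
           (s : (x : A) → β x → Fin N) where
    -- split s : β → {1,…,N}, with {1,…,N} represented by Fin N (k ↦ k+1)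
    open Data.Fin using () renaming (_≤_ to _≤F_)

    Neighbours : Fin N → (x y : A) → β x → β y → Set
    Neighbours k x y px py =
      (s x px ≡ k) × (s y py ≡ k) ×
      (∀ z (pz : β z) → Between x z y → k ≤F s z pz)

    Ramseyan : (A → A → Fin n) → Set
    Ramseyan σ = ∀ (k : Fin N) x y x' y'
      (px : β x) (py : β y) (px' : β x') (py' : β y') →
      x < y → x' < y' →
      Neighbours k x y px py → Neighbours k x x' px px' →
      Neighbours k x y' px py' → Neighbours k y x' py px' →
      Neighbours k y y' py py' → Neighbours k x' y' px' py' →
      (σ x y ≡ σ x' y') × (σ x y ≡ σ x y · σ x y)

module Submission where

-- Fix x0 ∈ β and an idempotent e ∈ D with e 𝓡 σ(x0,z) for all z > x0 and
-- e 𝓛 σ(w,x0) for all w < x0; it exists because σ(w,x0)σ(x0,z) = σ(w,z) ∈ D.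
-- For y ≥ x0 let c(y) = ρ(σ(y,z)) · σ(x0,y), where z > y is arbitrary (by
-- stability the 𝓡-class of σ(y,z) does not depend on z) and ρ chooses an
-- element of that 𝓡-class inside the 𝓛-class of e; the case y < x0 is the mirror
-- image. By Green's lemma c(x) = c(y) with x0 ≤ x < y forces
-- σ(x0,x) = σ(x0,x) σ(x,y), which makes σ(x,y) the idempotent of the 𝓗-class
-- of c(x). The split is c, read as an index into D with c(x0) = e put lowest.
-- Neighbours of colour ≠ e thus lie on one side of x0 and all their labels are
-- that idempotent; neighbours of colour e have all their labels equal to e.

open import Defs
open import Level using (0ℓ)
open import Data.Nat using (ℕ; _≤_)
open import Data.Fin using (Fin)
open import Data.Product using (Σ; ∃; _×_)
open import Relation.Binary.PropositionalEquality using (_≡_)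
open import Relation.Binary.Structures using (IsStrictTotalOrder)
open import Algebra.Core using (Op₂)
open import Algebra.Structures using (IsSemigroup)
open import Axiom.ExcludedMiddle using (ExcludedMiddle)

open import Data.Nat using (zero; suc; _+_; z≤n)
open import Data.Nat.Properties using (n<1+n; +-suc; m≤n⇒∃[o]m+o≡n; ≤-refl)
import Data.Fin as Fin
open import Data.Fin using (toℕ)
open import Data.Fin.Properties using (pigeonhole)
open import Data.Fin.Permutation.Components using (transpose; transpose-inverse)
open import Data.Product using (_,_; proj₁; proj₂)
open import Data.Sum using (_⊎_; inj₁; inj₂)
open import Data.Empty using (⊥-elim)
open import Data.Maybe using (fromMaybe)
open import Data.List using (List; _∷_; head; filter; allFin; lookup)
open import Data.List.Properties using (filter-≐; filter-accept)
open import Data.List.Relation.Unary.All using (All; _∷_)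
open import Data.List.Relation.Unary.All.Properties using (all-filter)
open import Data.List.Relation.Unary.Any using (there; index)
open import Data.List.Relation.Unary.Any.Properties using (lookup-index)
open import Data.List.Membership.Propositional using (_∈_)
open import Data.List.Membership.Propositional.Properties using (∈-filter⁺; ∈-allFin)
open import Function using (_∘_; flip)
open import Relation.Nullary using (Dec; yes; no)
open import Relation.Nullary.Decidable using (_×-dec_; dec-true)
open import Relation.Binary.Definitions using (Tri; tri<; tri≈; tri>)
open import Relation.Binary.PropositionalEquality
  using (_≢_; refl; sym; trans; cong; cong₂; subst; module ≡-Reasoning)
import Relation.Binary.Construct.Flip.EqAndOrd as FlipOrd
import Algebra.Construct.Flip.Op as Flip

module GreenRelations {n : ℕ} {_·_ : Op₂ (Fin n)} (isSemigroup : IsSemigroup _≡_ _·_) where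
  open IsSemigroup isSemigroup using (assoc)
  open Green _·_ using (_≤R_; _≤L_; _𝓡_)
  open ≡-Reasoning

  ≤R-refl : ∀ {a} → a ≤R a
  ≤R-refl = inj₁ refl

  ≤R-trans : ∀ {a b c} → a ≤R b → b ≤R c → a ≤R c
  ≤R-trans (inj₁ refl) b≤c = b≤c
  ≤R-trans (inj₂ a≤b) (inj₁ refl) = inj₂ a≤b
  ≤R-trans (inj₂ (u , refl)) (inj₂ (v , refl)) = inj₂ (v · u , assoc _ v u)

  x·y≤Rx : ∀ x y → (x · y) ≤R x
  x·y≤Rx x y = inj₂ (y , refl)

  𝓡-refl : ∀ {a} → a 𝓡 a
  𝓡-refl = ≤R-refl , ≤R-refl

  𝓡-sym : ∀ {a b} → a 𝓡 b → b 𝓡 a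
  𝓡-sym (p , q) = q , p

  𝓡-trans : ∀ {a b c} → a 𝓡 b → b 𝓡 c → a 𝓡 c
  𝓡-trans (p , q) (r , s) = ≤R-trans p r , ≤R-trans s q

  _≤J_ : Fin n → Fin n → Set
  a ≤J b = ∃ λ c → (a ≤L c) × (c ≤R b)

  ≤L-≤R-swap : ∀ {a b c} → a ≤L b → b ≤R c → ∃ λ b' → (a ≤R b') × (b' ≤L c)
  ≤L-≤R-swap {c = c} (inj₁ refl) b≤c = c , b≤c , inj₁ refl
  ≤L-≤R-swap {a} (inj₂ a≤b) (inj₁ refl) = a , inj₁ refl , inj₂ a≤b
  ≤L-≤R-swap {c = c} (inj₂ (u , refl)) (inj₂ (v , refl)) =
    u · c , inj₂ (v , sym (assoc u c v)) , inj₂ (u , refl)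

  idempotent-absorbs-≤R : ∀ {x e} → e · e ≡ e → x ≤R e → e · x ≡ x
  idempotent-absorbs-≤R ee≡e (inj₁ refl) = ee≡e
  idempotent-absorbs-≤R {e = e} ee≡e (inj₂ (u , refl)) =
    trans (sym (assoc e e u)) (cong (_· u) ee≡e)

  regular⇒idempotent-𝓡 : ∀ {v t} → (v · t) · v ≡ v →
                          ((v · t) · (v · t) ≡ v · t) × ((v · t) 𝓡 v)
  regular⇒idempotent-𝓡 {v} {t} vtv≡v =
    trans (sym (assoc (v · t) v t)) (cong (_· t) vtv≡v) ,
    x·y≤Rx v t , inj₂ (v , sym vtv≡v)

  -- w ^+ k stands for w^(1+k): a semigroup has no w^0.
  _^+_ : Fin n → ℕ → Fin n
  w ^+ zero = w
  w ^+ suc k = w · (w ^+ k)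

  ^+-+ : ∀ w i j → (w ^+ i) · (w ^+ j) ≡ w ^+ (i + suc j)
  ^+-+ w zero j = refl
  ^+-+ w (suc i) j = trans (assoc w (w ^+ i) (w ^+ j)) (cong (w ·_) (^+-+ w i j))

  ^+-comm : ∀ w k → (w ^+ k) · w ≡ w · (w ^+ k)
  ^+-comm w zero = refl
  ^+-comm w (suc k) = trans (assoc w (w ^+ k) w) (cong (w ·_) (^+-comm w k))

  sandwich-^+ : ∀ {a u w} → a ≡ u · (a · w) → ∀ k → a ≡ (u ^+ k) · (a · (w ^+ k))
  sandwich-^+ a≡uaw zero = a≡uaw
  sandwich-^+ {a} {u} {w} a≡uaw (suc k) = begin
    a                                       ≡⟨ a≡uaw ⟩
    u · (a · w)                             ≡⟨ cong (λ x → u · (x · w)) (sandwich-^+ a≡uaw k) ⟩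
    u · (((u ^+ k) · (a · (w ^+ k))) · w)   ≡⟨ cong (u ·_) (assoc (u ^+ k) _ w) ⟩
    u · ((u ^+ k) · ((a · (w ^+ k)) · w))   ≡⟨ sym (assoc u (u ^+ k) _) ⟩
    (u ^+ suc k) · ((a · (w ^+ k)) · w)     ≡⟨ cong ((u ^+ suc k) ·_) (assoc a (w ^+ k) w) ⟩
    (u ^+ suc k) · (a · ((w ^+ k) · w))     ≡⟨ cong (λ x → (u ^+ suc k) · (a · x)) (^+-comm w k) ⟩
    (u ^+ suc k) · (a · (w ^+ suc k))       ∎

  -- Two equal powers u ^+ i ≡ u ^+ (i + suc p), found by pigeonhole, let the
  -- left factors cancel out of a ≡ u^k a w^k, leaving a ≡ a w^(1+p).
  sandwich⇒≤R : ∀ {a u w} → a ≡ u · (a · w) → a ≤R (a · w)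
  sandwich⇒≤R {a} {u} {w} a≡uaw with pigeonhole (n<1+n n) (λ i → u ^+ toℕ i)
  ... | i , j , i<j , uⁱ≡uʲ with m≤n⇒∃[o]m+o≡n i<j
  ...   | p , i+1+p≡j = right-factor p a≡awᵖ
    where
    I = toℕ i
    uⁱ⁺¹⁺ᵖ≡uⁱ : u ^+ (I + suc p) ≡ u ^+ I
    uⁱ⁺¹⁺ᵖ≡uⁱ = trans (cong (u ^+_) (trans (+-suc I p) i+1+p≡j)) (sym uⁱ≡uʲ)
    a≡awᵖ : a ≡ a · (w ^+ p)
    a≡awᵖ = begin
      a                                              ≡⟨ sandwich-^+ a≡uaw (I + suc p) ⟩
      (u ^+ (I + suc p)) · (a · (w ^+ (I + suc p)))  ≡⟨ cong₂ (λ x y → x · (a · y)) uⁱ⁺¹⁺ᵖ≡uⁱ (sym (^+-+ w I p)) ⟩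
      (u ^+ I) · (a · ((w ^+ I) · (w ^+ p)))         ≡⟨ cong ((u ^+ I) ·_) (sym (assoc a (w ^+ I) (w ^+ p))) ⟩
      (u ^+ I) · ((a · (w ^+ I)) · (w ^+ p))         ≡⟨ sym (assoc (u ^+ I) _ (w ^+ p)) ⟩
      ((u ^+ I) · (a · (w ^+ I))) · (w ^+ p)         ≡⟨ cong (_· (w ^+ p)) (sym (sandwich-^+ a≡uaw I)) ⟩
      a · (w ^+ p)                                   ∎
    right-factor : ∀ q → a ≡ a · (w ^+ q) → a ≤R (a · w)
    right-factor zero a≡aw = inj₁ a≡aw
    right-factor (suc q) a≡awwq = inj₂ (w ^+ q , trans a≡awwq (sym (assoc a w (w ^+ q))))

  ≤J-·⇒≤R : ∀ {a b} → a ≤J (a · b) → a ≤R (a · b)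
  ≤J-·⇒≤R (_ , inj₁ refl , c≤ab) = c≤ab
  ≤J-·⇒≤R (_ , inj₂ (u , a≡u·ab) , inj₁ refl) = sandwich⇒≤R a≡u·ab
  ≤J-·⇒≤R {a} {b} (_ , inj₂ (u , a≡uc) , inj₂ (v , refl)) =
    ≤R-trans (sandwich⇒≤R (trans a≡uc (cong (u ·_) (assoc a b v))))
             (inj₂ (v , sym (assoc a b v)))

  ·-monoʳ-≤R : ∀ {a b} c → a ≤R b → (c · a) ≤R (c · b)
  ·-monoʳ-≤R c (inj₁ refl) = inj₁ refl
  ·-monoʳ-≤R {b = b} c (inj₂ (u , refl)) = inj₂ (u , sym (assoc c b u))

module JClass {n : ℕ} {_·_ : Op₂ (Fin n)} (isSemigroup : IsSemigroup _≡_ _·_) (d : Fin n) where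
  open IsSemigroup isSemigroup using (assoc)
  open Green _·_ using (_≤R_; _≤L_; _𝓡_; _𝓛_; _𝓓_; ≤R?; ≤L?)
  open GreenRelations isSemigroup public
  module Op = GreenRelations (Flip.isSemigroup isSemigroup)
  open Op public using ()
    renaming ( ≤R-trans to ≤L-trans; 𝓡-refl to 𝓛-refl; 𝓡-sym to 𝓛-sym; 𝓡-trans to 𝓛-trans
             ; ≤L-≤R-swap to ≤R-≤L-swap; idempotent-absorbs-≤R to idempotent-absorbs-≤L
             ; ·-monoʳ-≤R to ·-monoˡ-≤L)

  ≤J-trans : ∀ {a b c} → a ≤J b → b ≤J c → a ≤J c
  ≤J-trans (_ , a≤c₁ , c₁≤b) (_ , b≤c₂ , c₂≤c) with ≤R-≤L-swap c₁≤b b≤c₂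
  ... | _ , c₁≤c₃ , c₃≤c₂ = _ , ≤L-trans a≤c₁ c₁≤c₃ , ≤R-trans c₃≤c₂ c₂≤c

  ≤R⇒≤J : ∀ {a b} → a ≤R b → a ≤J b
  ≤R⇒≤J a≤b = _ , inj₁ refl , a≤b

  ≤L⇒≤J : ∀ {a b} → a ≤L b → a ≤J b
  ≤L⇒≤J a≤b = _ , a≤b , inj₁ refl

  ≤J⇒≤Jᵒᵖ : ∀ {a b} → a ≤J b → a Op.≤J b
  ≤J⇒≤Jᵒᵖ (_ , a≤c , c≤b) = ≤L-≤R-swap a≤c c≤b

  ≤Jᵒᵖ⇒≤J : ∀ {a b} → a Op.≤J b → a ≤J b
  ≤Jᵒᵖ⇒≤J (_ , a≤c , c≤b) = ≤R-≤L-swap a≤c c≤b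

  InJ : Fin n → Set
  InJ a = (a ≤J d) × (d ≤J a)

  InJᵒᵖ : Fin n → Set
  InJᵒᵖ a = (a Op.≤J d) × (d Op.≤J a)

  InJ⇒InJᵒᵖ : ∀ {a} → InJ a → InJᵒᵖ a
  InJ⇒InJᵒᵖ (a≤d , d≤a) = ≤J⇒≤Jᵒᵖ a≤d , ≤J⇒≤Jᵒᵖ d≤a

  InJᵒᵖ⇒InJ : ∀ {a} → InJᵒᵖ a → InJ a
  InJᵒᵖ⇒InJ (a≤d , d≤a) = ≤Jᵒᵖ⇒≤J a≤d , ≤Jᵒᵖ⇒≤J d≤a

  InJ-d : InJ d
  InJ-d = ≤R⇒≤J ≤R-refl , ≤R⇒≤J ≤R-refl

  InJ-resp-𝓡 : ∀ {a b} → a 𝓡 b → InJ b → InJ a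
  InJ-resp-𝓡 (a≤b , b≤a) (b≤d , d≤b) = ≤J-trans (≤R⇒≤J a≤b) b≤d , ≤J-trans d≤b (≤R⇒≤J b≤a)

  InJ-resp-𝓛 : ∀ {a b} → a 𝓛 b → InJ b → InJ a
  InJ-resp-𝓛 (a≤b , b≤a) (b≤d , d≤b) = ≤J-trans (≤L⇒≤J a≤b) b≤d , ≤J-trans d≤b (≤L⇒≤J b≤a)

  InJ⇒≤J : ∀ {a b} → InJ a → InJ b → a ≤J b
  InJ⇒≤J (a≤d , _) (_ , d≤b) = ≤J-trans a≤d d≤b

  𝓡-stable : ∀ {a b} → InJ a → InJ (a · b) → a 𝓡 (a · b)
  𝓡-stable {a} {b} a∈J ab∈J = ≤J-·⇒≤R (InJ⇒≤J a∈J ab∈J) , x·y≤Rx a b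

  𝓛-stable : ∀ {a b} → InJ b → InJ (a · b) → b 𝓛 (a · b)
  𝓛-stable {a} {b} b∈J ab∈J = Op.≤J-·⇒≤R (≤J⇒≤Jᵒᵖ (InJ⇒≤J b∈J ab∈J)) , Op.x·y≤Rx b a

  ≤R⇒𝓡 : ∀ {a b} → InJ a → InJ b → a ≤R b → a 𝓡 b
  ≤R⇒𝓡 a∈J b∈J (inj₁ refl) = 𝓡-refl
  ≤R⇒𝓡 a∈J b∈J (inj₂ (c , refl)) = 𝓡-sym (𝓡-stable b∈J a∈J)

  ≤L⇒𝓛 : ∀ {a b} → InJ a → InJ b → a ≤L b → a 𝓛 b
  ≤L⇒𝓛 a∈J b∈J (inj₁ refl) = 𝓛-refl
  ≤L⇒𝓛 a∈J b∈J (inj₂ (c , refl)) = 𝓛-sym (𝓛-stable b∈J a∈J)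

  𝓓⇒InJ : ∀ {a} → a 𝓓 d → InJ a
  𝓓⇒InJ (c , (a≤c , c≤a) , (c≤d , d≤c)) = (c , a≤c , c≤d) , ≤Jᵒᵖ⇒≤J (c , d≤c , c≤a)

  InJ⇒𝓓 : ∀ {a} → InJ a → a 𝓓 d
  InJ⇒𝓓 a∈J@((c , a≤c , c≤d) , d≤a) = c , ≤L⇒𝓛 a∈J c∈J a≤c , ≤R⇒𝓡 c∈J InJ-d c≤d
    where
    c∈J : InJ c
    c∈J = ≤R⇒≤J c≤d , ≤J-trans d≤a (≤L⇒≤J a≤c)

  𝓡∩𝓛-nonempty : ∀ {a b} → InJ a → InJ b → ∃ λ c → (c 𝓡 a) × (c 𝓛 b)
  𝓡∩𝓛-nonempty a∈J b∈J with ≤J⇒≤Jᵒᵖ (InJ⇒≤J a∈J b∈J)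
  ... | c , a≤c , c≤b = c , 𝓡-sym (≤R⇒𝓡 a∈J c∈J a≤c) , ≤L⇒𝓛 c∈J b∈J c≤b
    where
    c∈J : InJ c
    c∈J = ≤J-trans (≤L⇒≤J c≤b) (proj₁ b∈J) , ≤J-trans (proj₂ a∈J) (≤R⇒≤J a≤c)

  IdempotentIn𝓗 : Fin n → Fin n → Set
  IdempotentIn𝓗 h g = (g · g ≡ g) × (g 𝓡 h) × (g 𝓛 h)

  IdempotentIn𝓗-unique : ∀ {h g g'} → IdempotentIn𝓗 h g → IdempotentIn𝓗 h g' → g ≡ g'
  IdempotentIn𝓗-unique (gg≡g , g𝓡h , g𝓛h) (g'g'≡g' , g'𝓡h , g'𝓛h) =
    trans (sym (idempotent-absorbs-≤L g'g'≡g' (proj₁ (𝓛-trans g𝓛h (𝓛-sym g'𝓛h)))))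
          (idempotent-absorbs-≤R gg≡g (proj₁ (𝓡-trans g'𝓡h (𝓡-sym g𝓡h))))

  ·-𝓡-𝓛 : ∀ {e q p} → e · e ≡ e → q 𝓛 e → p 𝓡 e → ((q · p) 𝓡 q) × ((q · p) 𝓛 p)
  ·-𝓡-𝓛 {e} {q} {p} ee≡e (q≤e , e≤q) (p≤e , e≤p) =
    (x·y≤Rx q p , subst (_≤R (q · p)) (idempotent-absorbs-≤L ee≡e q≤e) (·-monoʳ-≤R q e≤p)) ,
    (Op.x·y≤Rx p q , subst (_≤L (q · p)) (idempotent-absorbs-≤R ee≡e p≤e) (·-monoˡ-≤L p e≤q))

  ·-cancelˡ-≤L : ∀ {c q a b} → c ≤L q → q · a ≡ q · b → c · a ≡ c · b
  ·-cancelˡ-≤L (inj₁ refl) qa≡qb = qa≡qb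
  ·-cancelˡ-≤L {q = q} {a} {b} (inj₂ (u , refl)) qa≡qb =
    trans (assoc u q a) (trans (cong (u ·_) qa≡qb) (sym (assoc u q b)))

  ≤L-fixed⇒idempotent : ∀ {g p} → g ≤L p → p · g ≡ p → g · g ≡ g
  ≤L-fixed⇒idempotent (inj₁ refl) pg≡p = pg≡p
  ≤L-fixed⇒idempotent {p = p} (inj₂ (u , refl)) pg≡p = trans (assoc u p (u · p)) (cong (u ·_) pg≡p)

fromMaybe-head-All : ∀ {A : Set} {P : A → Set} {x : A} {xs : List A} (default : A) →
                     All P xs → x ∈ xs → P (fromMaybe default (head xs))
fromMaybe-head-All _ (px ∷ _) _ = px

module 𝓡-classTransversal {n : ℕ} {_·_ : Op₂ (Fin n)} (isSemigroup : IsSemigroup _≡_ _·_)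
  (d : Fin n) {e : Fin n} (ee≡e : e · e ≡ e) (e∈J : JClass.InJ isSemigroup d e) where
  open Green _·_ using (_≤R_; _≤L_; _𝓡_; _𝓛_; ≤R?; ≤L?)
  open JClass isSemigroup d

  In𝓡∩𝓛e : Fin n → Fin n → Set
  In𝓡∩𝓛e a b = (b 𝓡 a) × (b 𝓛 e)

  in𝓡∩𝓛e? : ∀ a b → Dec (In𝓡∩𝓛e a b)
  in𝓡∩𝓛e? a b = (≤R? b a ×-dec ≤R? a b) ×-dec (≤L? b e ×-dec ≤L? e b)

  -- e is listed first, so that ρ a ≡ e whenever a 𝓡 e.
  ρ : Fin n → Fin n
  ρ a = fromMaybe e (head (filter (in𝓡∩𝓛e? a) (e ∷ allFin n)))

  ρ-spec : ∀ {a} → InJ a → In𝓡∩𝓛e a (ρ a)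
  ρ-spec {a} a∈J with 𝓡∩𝓛-nonempty a∈J e∈J
  ... | c , c∈𝓡∩𝓛 = fromMaybe-head-All e (all-filter (in𝓡∩𝓛e? a) (e ∷ allFin n))
                       (∈-filter⁺ (in𝓡∩𝓛e? a) (there {x = e} (∈-allFin c)) c∈𝓡∩𝓛)

  ρ-cong : ∀ {a a'} → a 𝓡 a' → ρ a ≡ ρ a'
  ρ-cong a𝓡a' = cong (fromMaybe e ∘ head)
    (filter-≐ (in𝓡∩𝓛e? _) (in𝓡∩𝓛e? _)
      ((λ (b𝓡a , b𝓛e) → 𝓡-trans b𝓡a a𝓡a' , b𝓛e) , (λ (b𝓡a' , b𝓛e) → 𝓡-trans b𝓡a' (𝓡-sym a𝓡a') , b𝓛e))
      (e ∷ allFin n))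

  ρ-e : ∀ {a} → a 𝓡 e → ρ a ≡ e
  ρ-e {a} a𝓡e =
    cong (fromMaybe e ∘ head) (filter-accept (in𝓡∩𝓛e? a) {x = e} {xs = allFin n} (𝓡-sym a𝓡e , 𝓛-refl))

  ρ·-𝓡 : ∀ {a p} → InJ a → p 𝓡 e → (ρ a · p) 𝓡 a
  ρ·-𝓡 a∈J p𝓡e = let (ρa𝓡a , ρa𝓛e) = ρ-spec a∈J in 𝓡-trans (proj₁ (·-𝓡-𝓛 ee≡e ρa𝓛e p𝓡e)) ρa𝓡a

  ρ·-𝓛 : ∀ {a p} → InJ a → p 𝓡 e → (ρ a · p) 𝓛 p
  ρ·-𝓛 a∈J p𝓡e = proj₂ (·-𝓡-𝓛 ee≡e (proj₂ (ρ-spec a∈J)) p𝓡e)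

  -- The product determines the 𝓡-class of a, hence ρ a, which then cancels as e ≤L ρ a.
  ρ·-injective : ∀ {a a' p p'} → InJ a → InJ a' → p 𝓡 e → p' 𝓡 e → ρ a · p ≡ ρ a' · p' → p ≡ p'
  ρ·-injective {a} {a'} {p} {p'} a∈J a'∈J p𝓡e p'𝓡e eq = begin
    p           ≡⟨ sym (idempotent-absorbs-≤R ee≡e (proj₁ p𝓡e)) ⟩
    e · p       ≡⟨ ·-cancelˡ-≤L (proj₂ (proj₂ (ρ-spec a∈J))) (trans eq (cong (_· p') (sym ρa≡ρa'))) ⟩
    e · p'      ≡⟨ idempotent-absorbs-≤R ee≡e (proj₁ p'𝓡e) ⟩
    p'          ∎
    where
    open ≡-Reasoning
    ρa≡ρa' : ρ a ≡ ρ a'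
    ρa≡ρa' = ρ-cong (𝓡-trans (𝓡-sym (ρ·-𝓡 a∈J p𝓡e)) (subst (_𝓡 a') (sym eq) (ρ·-𝓡 a'∈J p'𝓡e)))

module AdditiveLabelling {n : ℕ} {_·_ : Op₂ (Fin n)} (isSemigroup : IsSemigroup _≡_ _·_) (d : Fin n)
  {A : Set} {_<_ : A → A → Set} (sto : IsStrictTotalOrder _≡_ _<_)
  {σ : A → A → Fin n} (additive : Labelling.Additive _<_ _·_ σ)
  {β : A → Set} (σ∈J : Labelling.LabelsIn _<_ _·_ σ β (JClass.InJ isSemigroup d)) where
  open Green _·_ using (_𝓡_)
  open JClass isSemigroup d
  open IsStrictTotalOrder sto using (compare) renaming (trans to <-trans)

  σ-𝓡-extend : ∀ {x z z'} → β x → β z → β z' → x < z → z < z' → σ x z 𝓡 σ x z'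
  σ-𝓡-extend {x} {z} {z'} x∈β z∈β z'∈β x<z z<z' =
    subst (σ x z 𝓡_) σxz·σzz'≡σxz'
      (𝓡-stable (σ∈J x z x∈β z∈β x<z)
                (subst InJ (sym σxz·σzz'≡σxz') (σ∈J x z' x∈β z'∈β (<-trans x<z z<z'))))
    where σxz·σzz'≡σxz' = additive x z z' x<z z<z'

  σ-𝓡 : ∀ {x z z'} → β x → β z → β z' → x < z → x < z' → σ x z 𝓡 σ x z'
  σ-𝓡 {z = z} {z'} x∈β z∈β z'∈β x<z x<z' with compare z z'
  ... | tri< z<z' _ _ = σ-𝓡-extend x∈β z∈β z'∈β x<z z<z'
  ... | tri≈ _ refl _ = 𝓡-refl
  ... | tri> _ _ z'<z = 𝓡-sym (σ-𝓡-extend x∈β z'∈β z∈β x<z' z'<z)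

module OneSidedColouring {n : ℕ} {_·_ : Op₂ (Fin n)} (isSemigroup : IsSemigroup _≡_ _·_) (d : Fin n)
  {A : Set} {_<_ : A → A → Set} (sto : IsStrictTotalOrder _≡_ _<_) (em : ExcludedMiddle 0ℓ)
  {σ : A → A → Fin n} (additive : Labelling.Additive _<_ _·_ σ)
  {β : A → Set} (σ∈J : Labelling.LabelsIn _<_ _·_ σ β (JClass.InJ isSemigroup d))
  {x0 : A} (x0∈β : β x0) {e : Fin n} (ee≡e : e · e ≡ e) (e∈J : JClass.InJ isSemigroup d e)
  (e𝓡σ : ∀ z → β z → x0 < z → Green._𝓡_ _·_ e (σ x0 z)) where
  open Green _·_ using (_𝓡_; _𝓛_)
  open JClass isSemigroup d
  open AdditiveLabelling isSemigroup d sto additive σ∈J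
  open 𝓡-classTransversal isSemigroup d ee≡e e∈J
  open IsStrictTotalOrder sto using (compare) renaming (trans to <-trans)
  open Order _<_ using () renaming (_≤_ to _≼_)

  ≼-<-trans : ∀ {x y z} → x ≼ y → y < z → x < z
  ≼-<-trans (inj₁ x<y) y<z = <-trans x<y y<z
  ≼-<-trans (inj₂ refl) y<z = y<z

  HasSuccessor : A → Set
  HasSuccessor y = ∃ λ z → β z × y < z

  labelAfter : A → Fin n
  labelAfter y with em {HasSuccessor y}
  ... | yes (z , _) = σ y z
  ... | no _ = e

  labelAfter-∈J : ∀ {y} → β y → InJ (labelAfter y)
  labelAfter-∈J {y} y∈β with em {HasSuccessor y}
  ... | yes (z , z∈β , y<z) = σ∈J y z y∈β z∈β y<z
  ... | no _ = e∈J

  σ-𝓡-labelAfter : ∀ {x y} → β x → β y → x < y → σ x y 𝓡 labelAfter x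
  σ-𝓡-labelAfter {x} {y} x∈β y∈β x<y with em {HasSuccessor x}
  ... | yes (z , z∈β , x<z) = σ-𝓡 x∈β y∈β z∈β x<y x<z
  ... | no ∄z = ⊥-elim (∄z (y , y∈β , x<y))

  labelAfter-x0 : labelAfter x0 𝓡 e
  labelAfter-x0 with em {HasSuccessor x0}
  ... | yes (z , z∈β , x0<z) = 𝓡-sym (e𝓡σ z z∈β x0<z)
  ... | no _ = 𝓡-refl

  -- σ(x0,y), read as e at y = x0; the value e for y < x0 is never used.
  labelFromBase : A → Fin n
  labelFromBase y with compare x0 y
  ... | tri< _ _ _ = σ x0 y
  ... | tri≈ _ _ _ = e
  ... | tri> _ _ _ = e

  labelFromBase-< : ∀ {y} → x0 < y → labelFromBase y ≡ σ x0 y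
  labelFromBase-< {y} x0<y with compare x0 y
  ... | tri< _ _ _ = refl
  ... | tri≈ x0≮y _ _ = ⊥-elim (x0≮y x0<y)
  ... | tri> x0≮y _ _ = ⊥-elim (x0≮y x0<y)

  labelFromBase-x0 : labelFromBase x0 ≡ e
  labelFromBase-x0 with compare x0 x0
  ... | tri< _ x0≢x0 _ = ⊥-elim (x0≢x0 refl)
  ... | tri≈ _ _ _ = refl
  ... | tri> _ x0≢x0 _ = ⊥-elim (x0≢x0 refl)

  labelFromBase-𝓡 : ∀ {y} → β y → x0 ≼ y → labelFromBase y 𝓡 e
  labelFromBase-𝓡 y∈β (inj₁ x0<y) rewrite labelFromBase-< x0<y = 𝓡-sym (e𝓡σ _ y∈β x0<y)
  labelFromBase-𝓡 _ (inj₂ refl) rewrite labelFromBase-x0 = 𝓡-refl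

  labelFromBase-∈J : ∀ {y} → β y → x0 ≼ y → InJ (labelFromBase y)
  labelFromBase-∈J y∈β x0≼y = InJ-resp-𝓡 (labelFromBase-𝓡 y∈β x0≼y) e∈J

  labelFromBase-step : ∀ {x y} → β y → x0 ≼ x → x < y → labelFromBase y ≡ labelFromBase x · σ x y
  labelFromBase-step {x} {y} _ (inj₁ x0<x) x<y
    rewrite labelFromBase-< x0<x | labelFromBase-< (<-trans x0<x x<y) = sym (additive x0 x y x0<x x<y)
  labelFromBase-step y∈β (inj₂ refl) x0<y
    rewrite labelFromBase-x0 | labelFromBase-< x0<y =
      sym (idempotent-absorbs-≤R ee≡e (proj₂ (e𝓡σ _ y∈β x0<y)))

  colour : A → Fin n
  colour y = ρ (labelAfter y) · labelFromBase y

  colour-∈J : ∀ {y} → β y → x0 ≼ y → InJ (colour y)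
  colour-∈J {y} y∈β x0≼y =
    InJ-resp-𝓡 (ρ·-𝓡 (labelAfter-∈J y∈β) (labelFromBase-𝓡 y∈β x0≼y)) (labelAfter-∈J y∈β)

  colour-x0 : colour x0 ≡ e
  colour-x0 = trans (cong₂ _·_ (ρ-e labelAfter-x0) labelFromBase-x0) ee≡e

  -- Equal colours force labelFromBase x ≡ labelFromBase y ≡ labelFromBase x · σ x y,
  -- which pins σ x y to an idempotent.
  σ-IdempotentIn𝓗 : ∀ {x y} → β x → β y → x0 ≼ x → x < y → colour x ≡ colour y →
                    IdempotentIn𝓗 (colour x) (σ x y)
  σ-IdempotentIn𝓗 {x} {y} x∈β y∈β x0≼x x<y cx≡cy =
    ≤L-fixed⇒idempotent (proj₁ σ𝓛base) (sym base≡base·σ) ,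
    𝓡-trans (σ-𝓡-labelAfter x∈β y∈β x<y) (𝓡-sym (ρ·-𝓡 (labelAfter-∈J x∈β) base𝓡e)) ,
    𝓛-trans σ𝓛base (𝓛-sym (ρ·-𝓛 (labelAfter-∈J x∈β) base𝓡e))
    where
    x0≼y = inj₁ (≼-<-trans x0≼x x<y)
    base𝓡e = labelFromBase-𝓡 x∈β x0≼x
    base≡base·σ : labelFromBase x ≡ labelFromBase x · σ x y
    base≡base·σ = trans (ρ·-injective (labelAfter-∈J x∈β) (labelAfter-∈J y∈β) base𝓡e
                                       (labelFromBase-𝓡 y∈β x0≼y) cx≡cy)
                        (labelFromBase-step y∈β x0≼x x<y)
    σ𝓛base : σ x y 𝓛 labelFromBase x
    σ𝓛base = subst (σ x y 𝓛_) (sym base≡base·σ)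
      (𝓛-stable (σ∈J x y x∈β y∈β x<y) (subst InJ base≡base·σ (labelFromBase-∈J x∈β x0≼x)))

module RegularJClass {n : ℕ} {_·_ : Op₂ (Fin n)} (isSemigroup : IsSemigroup _≡_ _·_) {d : Fin n}
  (reg : Green.RegularDClass _·_ d) where
  open IsSemigroup isSemigroup using (assoc)
  open Green _·_ using (_𝓡_; _𝓛_)
  open JClass isSemigroup d
  open ≡-Reasoning

  regular : ∀ {a} → InJ a → ∃ λ t → (a · t) · a ≡ a
  regular a∈J = reg _ (InJ⇒𝓓 a∈J)

  idempotent-𝓡 : ∀ {v} → InJ v → ∃ λ e → (e · e ≡ e) × (e 𝓡 v)
  idempotent-𝓡 v∈J = _ , regular⇒idempotent-𝓡 (proj₂ (regular v∈J))

  idempotent-𝓛 : ∀ {u} → InJ u → ∃ λ e → (e · e ≡ e) × (e 𝓛 u)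
  idempotent-𝓛 {u} u∈J with regular u∈J
  ... | t , utu≡u = _ , Op.regular⇒idempotent-𝓡 (trans (sym (assoc u t u)) utu≡u)

  -- With m = u · v and m t m = m, the idempotent is v t u.
  idempotent-𝓡-𝓛 : ∀ {u v} → InJ u → InJ v → InJ (u · v) → ∃ λ e → (e · e ≡ e) × (e 𝓡 v) × (e 𝓛 u)
  idempotent-𝓡-𝓛 {u} {v} u∈J v∈J uv∈J with regular uv∈J
  ... | t , mtm≡m = e , ee≡e , (x·y≤Rx v (t · u) , inj₂ (v , sym ev≡v)) ,
                    (inj₂ (v · t , sym (assoc v t u)) , inj₂ (u , sym ue≡u))
    where
    m = u · v
    e = v · (t · u)
    mt-idempotent = regular⇒idempotent-𝓡 mtm≡m
    tm-idempotent = Op.regular⇒idempotent-𝓡 {m} {t} (trans (sym (assoc m t m)) mtm≡m)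
    ev≡v : e · v ≡ v
    ev≡v = begin
      (v · (t · u)) · v  ≡⟨ assoc v (t · u) v ⟩
      v · ((t · u) · v)  ≡⟨ cong (v ·_) (assoc t u v) ⟩
      v · (t · m)        ≡⟨ idempotent-absorbs-≤L (proj₁ tm-idempotent)
                              (≤L-trans (proj₁ (𝓛-stable v∈J uv∈J)) (proj₂ (proj₂ tm-idempotent))) ⟩
      v                  ∎
    ue≡u : u · e ≡ u
    ue≡u = begin
      u · (v · (t · u))  ≡⟨ sym (assoc u v (t · u)) ⟩
      m · (t · u)        ≡⟨ sym (assoc m t u) ⟩
      (m · t) · u        ≡⟨ idempotent-absorbs-≤R (proj₁ mt-idempotent)
                              (≤R-trans (proj₁ (𝓡-stable u∈J uv∈J)) (proj₂ (proj₂ mt-idempotent))) ⟩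
      u                  ∎
    ee≡e : e · e ≡ e
    ee≡e = begin
      (v · (t · u)) · e  ≡⟨ assoc v (t · u) e ⟩
      v · ((t · u) · e)  ≡⟨ cong (v ·_) (assoc t u e) ⟩
      v · (t · (u · e))  ≡⟨ cong (λ x → v · (t · x)) ue≡u ⟩
      e                  ∎

module 𝓓-classIndex {n : ℕ} (_·_ : Op₂ (Fin n)) (d : Fin n) where
  open Green _·_ using (_𝓓_; 𝓓?; ∣Dclass∣)

  𝓓-class : List (Fin n)
  𝓓-class = filter (λ a → 𝓓? a d) (allFin n)

  ∈-𝓓-class : ∀ {a} → a 𝓓 d → a ∈ 𝓓-class
  ∈-𝓓-class a𝓓d = ∈-filter⁺ (λ a → 𝓓? a d) (∈-allFin _) a𝓓d

  𝓓-index : ∀ {a} → a 𝓓 d → Fin (∣Dclass∣ d)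
  𝓓-index a𝓓d = index (∈-𝓓-class a𝓓d)

  𝓓-index-injective : ∀ {a b} (a𝓓d : a 𝓓 d) (b𝓓d : b 𝓓 d) → 𝓓-index a𝓓d ≡ 𝓓-index b𝓓d → a ≡ b
  𝓓-index-injective a𝓓d b𝓓d eq =
    trans (lookup-index (∈-𝓓-class a𝓓d))
          (trans (cong (lookup 𝓓-class) eq) (sym (lookup-index (∈-𝓓-class b𝓓d))))

zeroOf : ∀ {m} → Fin m → Fin m
zeroOf {suc _} _ = Fin.zero

≤zeroOf⇒≡ : ∀ {m} {k i : Fin m} → k Fin.≤ zeroOf i → k ≡ zeroOf i
≤zeroOf⇒≡ {suc _} {Fin.zero} _ = refl

transpose-injective : ∀ {m} (i j : Fin m) {a b} → transpose i j a ≡ transpose i j b → a ≡ b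
transpose-injective i j {a} {b} eq =
  trans (sym (transpose-inverse j i)) (trans (cong (transpose j i) eq) (transpose-inverse j i))

transpose-source : ∀ {m} (i j : Fin m) → transpose i j i ≡ j
transpose-source i j rewrite dec-true (i Fin.≟ i) refl = refl

module RamseyanSplit (em : ExcludedMiddle 0ℓ)
  {n : ℕ} {_·_ : Op₂ (Fin n)} (isSemigroup : IsSemigroup _≡_ _·_)
  {A : Set} {_<_ : A → A → Set} (sto : IsStrictTotalOrder _≡_ _<_)
  {σ : A → A → Fin n} (additive : Labelling.Additive _<_ _·_ σ)
  {d : Fin n} (reg : Green.RegularDClass _·_ d)
  {β : A → Set} (σ∈𝓓 : Labelling.LabelsIn _<_ _·_ σ β (λ a → Green._𝓓_ _·_ a d)) where
  open Green _·_ using (_𝓡_; _𝓛_; ∣Dclass∣)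
  open JClass isSemigroup d
  open RegularJClass isSemigroup reg
  open 𝓓-classIndex _·_ d
  open IsStrictTotalOrder sto using (compare) renaming (trans to <-trans)
  open Order _<_ using (Between) renaming (_≤_ to _≼_)

  σ∈J : Labelling.LabelsIn _<_ _·_ σ β InJ
  σ∈J x y x∈β y∈β x<y = 𝓓⇒InJ (σ∈𝓓 x y x∈β y∈β x<y)

  isSemigroupᵒᵖ : IsSemigroup _≡_ (flip _·_)
  isSemigroupᵒᵖ = Flip.isSemigroup isSemigroup

  stoᵒᵖ : IsStrictTotalOrder _≡_ (flip _<_)
  stoᵒᵖ = FlipOrd.isStrictTotalOrder sto

  additiveᵒᵖ : Labelling.Additive (flip _<_) (flip _·_) (flip σ)
  additiveᵒᵖ x y z y<x z<y = additive z y x z<y y<x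

  σᵒᵖ∈J : Labelling.LabelsIn (flip _<_) (flip _·_) (flip σ) β InJᵒᵖ
  σᵒᵖ∈J x y x∈β y∈β y<x = InJ⇒InJᵒᵖ (σ∈J y x y∈β x∈β y<x)

  module Forward = AdditiveLabelling isSemigroup d sto additive σ∈J
  module Backward = AdditiveLabelling isSemigroupᵒᵖ d stoᵒᵖ additiveᵒᵖ σᵒᵖ∈J

  record Anchor (x0 : A) (e : Fin n) : Set where
    constructor anchored
    field
      idempotent : e · e ≡ e
      e∈J : InJ e
      𝓡-onward : ∀ z → β z → x0 < z → e 𝓡 σ x0 z
      𝓛-backward : ∀ w → β w → w < x0 → e 𝓛 σ w x0

  𝓡-onward-from : ∀ {x0 z e} → β x0 → β z → x0 < z → e 𝓡 σ x0 z → ∀ z' → β z' → x0 < z' → e 𝓡 σ x0 z'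
  𝓡-onward-from x0∈β z∈β x0<z e𝓡σ _ z'∈β x0<z' = 𝓡-trans e𝓡σ (Forward.σ-𝓡 x0∈β z∈β z'∈β x0<z x0<z')

  𝓛-backward-from : ∀ {x0 w e} → β x0 → β w → w < x0 → e 𝓛 σ w x0 → ∀ w' → β w' → w' < x0 → e 𝓛 σ w' x0
  𝓛-backward-from x0∈β w∈β w<x0 e𝓛σ _ w'∈β w'<x0 = 𝓛-trans e𝓛σ (Backward.σ-𝓡 x0∈β w∈β w'∈β w<x0 w'<x0)

  anchor : ∀ {x0} → β x0 → ∃ (Anchor x0)
  anchor {x0} x0∈β with em {∃ λ z → β z × x0 < z} | em {∃ λ w → β w × w < x0}
  ... | yes (z , z∈β , x0<z) | yes (w , w∈β , w<x0)
    with idempotent-𝓡-𝓛 (σ∈J w x0 w∈β x0∈β w<x0) (σ∈J x0 z x0∈β z∈β x0<z)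
           (subst InJ (sym (additive w x0 z w<x0 x0<z)) (σ∈J w z w∈β z∈β (<-trans w<x0 x0<z)))
  ... | e , ee≡e , e𝓡σ , e𝓛σ = e , anchored ee≡e (InJ-resp-𝓡 e𝓡σ (σ∈J x0 z x0∈β z∈β x0<z))
          (𝓡-onward-from x0∈β z∈β x0<z e𝓡σ) (𝓛-backward-from x0∈β w∈β w<x0 e𝓛σ)
  anchor {x0} x0∈β | yes (z , z∈β , x0<z) | no ∄w with idempotent-𝓡 (σ∈J x0 z x0∈β z∈β x0<z)
  ... | e , ee≡e , e𝓡σ = e , anchored ee≡e (InJ-resp-𝓡 e𝓡σ (σ∈J x0 z x0∈β z∈β x0<z))
          (𝓡-onward-from x0∈β z∈β x0<z e𝓡σ) (λ _ w'∈β w'<x0 → ⊥-elim (∄w (_ , w'∈β , w'<x0)))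
  anchor {x0} x0∈β | no ∄z | yes (w , w∈β , w<x0) with idempotent-𝓛 (σ∈J w x0 w∈β x0∈β w<x0)
  ... | e , ee≡e , e𝓛σ = e , anchored ee≡e (InJ-resp-𝓛 e𝓛σ (σ∈J w x0 w∈β x0∈β w<x0))
          (λ _ z'∈β x0<z' → ⊥-elim (∄z (_ , z'∈β , x0<z'))) (𝓛-backward-from x0∈β w∈β w<x0 e𝓛σ)
  anchor {x0} x0∈β | no ∄z | no ∄w with idempotent-𝓡 InJ-d
  ... | e , ee≡e , e𝓡d = e , anchored ee≡e (InJ-resp-𝓡 e𝓡d InJ-d)
          (λ _ z'∈β x0<z' → ⊥-elim (∄z (_ , z'∈β , x0<z')))
          (λ _ w'∈β w'<x0 → ⊥-elim (∄w (_ , w'∈β , w'<x0)))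

  module Split {x0 : A} (x0∈β : β x0) {e : Fin n} (a : Anchor x0 e) where
    open Anchor a
    module Right = OneSidedColouring isSemigroup d sto em additive σ∈J x0∈β idempotent e∈J 𝓡-onward
    module Left = OneSidedColouring isSemigroupᵒᵖ d stoᵒᵖ em additiveᵒᵖ σᵒᵖ∈J x0∈β idempotent
                    (InJ⇒InJᵒᵖ e∈J) 𝓛-backward

    side : ∀ z → x0 ≼ z ⊎ z < x0
    side z with compare x0 z
    ... | tri< x0<z _ _ = inj₁ (inj₁ x0<z)
    ... | tri≈ _ x0≡z _ = inj₁ (inj₂ x0≡z)
    ... | tri> _ _ z<x0 = inj₂ z<x0

    colourBy : ∀ {z} → Tri (x0 < z) (x0 ≡ z) (z < x0) → Fin n
    colourBy {z} (tri> _ _ _) = Left.colour z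
    colourBy {z} _ = Right.colour z

    colour : A → Fin n
    colour z = colourBy (compare x0 z)

    colour-right : ∀ {z} → x0 ≼ z → colour z ≡ Right.colour z
    colour-right {z} x0≼z = by-right (compare x0 z) x0≼z
      where
      by-right : (t : Tri (x0 < z) (x0 ≡ z) (z < x0)) → x0 ≼ z → colourBy t ≡ Right.colour z
      by-right (tri< _ _ _) _ = refl
      by-right (tri≈ _ _ _) _ = refl
      by-right (tri> x0≮z _ _) (inj₁ x0<z) = ⊥-elim (x0≮z x0<z)
      by-right (tri> _ x0≢z _) (inj₂ x0≡z) = ⊥-elim (x0≢z x0≡z)

    colour-x0 : colour x0 ≡ e
    colour-x0 = trans (colour-right (inj₂ refl)) Right.colour-x0

    colour-left : ∀ {z} → z < x0 ⊎ x0 ≡ z → colour z ≡ Left.colour z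
    colour-left {z} (inj₁ z<x0) = by-left (compare x0 z)
      where
      by-left : (t : Tri (x0 < z) (x0 ≡ z) (z < x0)) → colourBy t ≡ Left.colour z
      by-left (tri< _ _ z≮x0) = ⊥-elim (z≮x0 z<x0)
      by-left (tri≈ _ _ z≮x0) = ⊥-elim (z≮x0 z<x0)
      by-left (tri> _ _ _) = refl
    colour-left (inj₂ refl) = trans colour-x0 (sym Left.colour-x0)

    colour-∈J : ∀ {z} → β z → InJ (colour z)
    colour-∈J {z} z∈β with side z
    ... | inj₁ x0≼z = subst InJ (sym (colour-right x0≼z)) (Right.colour-∈J z∈β x0≼z)
    ... | inj₂ z<x0 =
      subst InJ (sym (colour-left (inj₁ z<x0))) (InJᵒᵖ⇒InJ (Left.colour-∈J z∈β (inj₁ z<x0)))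

    OnOneSide : A → A → Set
    OnOneSide a b = x0 ≼ a ⊎ (b < x0 ⊎ x0 ≡ b)

    σ-IdempotentIn𝓗 : ∀ {a b} → β a → β b → a < b → colour a ≡ colour b → OnOneSide a b →
                      IdempotentIn𝓗 (colour a) (σ a b)
    σ-IdempotentIn𝓗 {a} {b} a∈β b∈β a<b ca≡cb (inj₁ x0≼a) =
      subst (λ c → IdempotentIn𝓗 c (σ a b)) (sym (colour-right x0≼a))
        (Right.σ-IdempotentIn𝓗 a∈β b∈β x0≼a a<b
          (trans (sym (colour-right x0≼a)) (trans ca≡cb (colour-right x0≼b))))
      where x0≼b = inj₁ (Right.≼-<-trans x0≼a a<b)
    σ-IdempotentIn𝓗 {a} {b} a∈β b∈β a<b ca≡cb (inj₂ b≼x0) =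
      subst (λ c → IdempotentIn𝓗 c (σ a b)) (sym ca≡Lcb) (σσ≡σ , σ𝓡 , σ𝓛)
      where
      a≼x0 = inj₁ (Left.≼-<-trans b≼x0 a<b)
      ca≡Lcb = trans ca≡cb (colour-left b≼x0)
      idem = Left.σ-IdempotentIn𝓗 b∈β a∈β b≼x0 a<b
               (trans (sym (colour-left b≼x0)) (trans (sym ca≡cb) (colour-left a≼x0)))
      σσ≡σ = proj₁ idem
      σ𝓡 = proj₂ (proj₂ idem)
      σ𝓛 = proj₁ (proj₂ idem)

    σ≡e-on-one-side : ∀ {a b} → β a → β b → a < b → colour a ≡ e → colour b ≡ e →
                      OnOneSide a b → σ a b ≡ e
    σ≡e-on-one-side a∈β b∈β a<b ca≡e cb≡e side =
      IdempotentIn𝓗-unique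
        (subst (λ c → IdempotentIn𝓗 c _) ca≡e (σ-IdempotentIn𝓗 a∈β b∈β a<b (trans ca≡e (sym cb≡e)) side))
        (idempotent , 𝓡-refl , 𝓛-refl)

    σ≡e : ∀ {a b} → β a → β b → a < b → colour a ≡ e → colour b ≡ e → σ a b ≡ e
    σ≡e {a} {b} a∈β b∈β a<b ca≡e cb≡e with side a | side b
    ... | inj₁ x0≼a | _ = σ≡e-on-one-side a∈β b∈β a<b ca≡e cb≡e (inj₁ x0≼a)
    ... | inj₂ _ | inj₁ (inj₂ x0≡b) = σ≡e-on-one-side a∈β b∈β a<b ca≡e cb≡e (inj₂ (inj₂ x0≡b))
    ... | inj₂ _ | inj₂ b<x0 = σ≡e-on-one-side a∈β b∈β a<b ca≡e cb≡e (inj₂ (inj₁ b<x0))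
    ... | inj₂ a<x0 | inj₁ (inj₁ x0<b) = begin
      σ a b            ≡⟨ sym (additive a x0 b a<x0 x0<b) ⟩
      σ a x0 · σ x0 b  ≡⟨ cong₂ _·_ (σ≡e-on-one-side a∈β x0∈β a<x0 ca≡e colour-x0 (inj₂ (inj₂ refl)))
                                   (σ≡e-on-one-side x0∈β b∈β x0<b colour-x0 cb≡e (inj₁ (inj₂ refl))) ⟩
      e · e            ≡⟨ idempotent ⟩
      e                ∎
      where open ≡-Reasoning

    ι₀ : Fin (∣Dclass∣ d)
    ι₀ = 𝓓-index (InJ⇒𝓓 (colour-∈J x0∈β))

    -- The transposition gives colour x0 ≡ e the least index.
    split : (x : A) → β x → Fin (∣Dclass∣ d)
    split x x∈β = transpose ι₀ (zeroOf ι₀) (𝓓-index (InJ⇒𝓓 (colour-∈J x∈β)))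

    split-injective : ∀ {x y} (x∈β : β x) (y∈β : β y) → split x x∈β ≡ split y y∈β → colour x ≡ colour y
    split-injective x∈β y∈β eq = 𝓓-index-injective _ _ (transpose-injective ι₀ (zeroOf ι₀) eq)

    open Labelling _<_ _·_ using (Neighbours; Ramseyan)

    colour-Neighbours : ∀ {k p q p∈β q∈β} → Neighbours β split k p q p∈β q∈β → colour p ≡ colour q
    colour-Neighbours {p∈β = p∈β} {q∈β} (sp≡k , sq≡k , _) =
      split-injective p∈β q∈β (trans sp≡k (sym sq≡k))

    Neighbours-across-x0 : ∀ {k p q p∈β q∈β} → Neighbours β split k p q p∈β q∈β →
                           Between p x0 q → colour p ≡ e
    Neighbours-across-x0 {p∈β = p∈β} (sp≡k , _ , k≤split) x0-between =
      trans (split-injective p∈β x0∈β (trans sp≡k (trans k≡0 (sym split-x0≡0)))) colour-x0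
      where
      split-x0≡0 : split x0 x0∈β ≡ zeroOf ι₀
      split-x0≡0 = transpose-source ι₀ (zeroOf ι₀)
      k≡0 = ≤zeroOf⇒≡ (subst (_ Fin.≤_) split-x0≡0 (k≤split x0 x0∈β x0-between))

    Neighbours-on-one-side : ∀ {k p q p∈β q∈β} → Neighbours β split k p q p∈β q∈β →
                             colour p ≢ e → OnOneSide p q
    Neighbours-on-one-side {p = p} {q} nbr cp≢e = on-one-side (side p) (side q)
      where
      on-one-side : x0 ≼ p ⊎ p < x0 → x0 ≼ q ⊎ q < x0 → OnOneSide p q
      on-one-side (inj₁ x0≼p) _ = inj₁ x0≼p
      on-one-side (inj₂ _) (inj₁ (inj₂ x0≡q)) = inj₂ (inj₂ x0≡q)
      on-one-side (inj₂ _) (inj₂ q<x0) = inj₂ (inj₁ q<x0)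
      on-one-side (inj₂ p<x0) (inj₁ (inj₁ x0<q)) =
        ⊥-elim (cp≢e (Neighbours-across-x0 nbr (inj₁ (inj₁ p<x0 , inj₁ x0<q))))

    ramseyan : Ramseyan β split σ
    ramseyan k x y x' y' x∈β y∈β x'∈β y'∈β x<y x'<y' nxy nxx' _ _ _ nx'y' = by-colour (colour x Fin.≟ e)
      where
      cx≡cx' = colour-Neighbours nxx'
      by-colour : Dec (colour x ≡ e) → (σ x y ≡ σ x' y') × (σ x y ≡ σ x y · σ x y)
      by-colour (yes cx≡e) =
        trans σxy≡e (sym σx'y'≡e) , trans σxy≡e (sym (trans (cong₂ _·_ σxy≡e σxy≡e) idempotent))
        where
        cx'≡e = trans (sym cx≡cx') cx≡e
        σxy≡e = σ≡e x∈β y∈β x<y cx≡e (trans (sym (colour-Neighbours nxy)) cx≡e)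
        σx'y'≡e = σ≡e x'∈β y'∈β x'<y' cx'≡e (trans (sym (colour-Neighbours nx'y')) cx'≡e)
      by-colour (no cx≢e) = IdempotentIn𝓗-unique σxy-idem σx'y'-idem , sym (proj₁ σxy-idem)
        where
        σxy-idem = σ-IdempotentIn𝓗 x∈β y∈β x<y (colour-Neighbours nxy) (Neighbours-on-one-side nxy cx≢e)
        σx'y'-idem : IdempotentIn𝓗 (colour x) (σ x' y')
        σx'y'-idem = subst (λ c → IdempotentIn𝓗 c (σ x' y')) (sym cx≡cx')
          (σ-IdempotentIn𝓗 x'∈β y'∈β x'<y' (colour-Neighbours nx'y')
            (Neighbours-on-one-side nx'y' (cx≢e ∘ trans cx≡cx')))

lemma4 : ExcludedMiddle 0ℓ →
    (n : ℕ) (_·_ : Op₂ (Fin n)) → IsSemigroup _≡_ _·_ →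
    (A : Set) (_<_ : A → A → Set) → IsStrictTotalOrder _≡_ _<_ →
    Order.Complete _<_ →
    (σ : A → A → Fin n) → Labelling.Additive _<_ _·_ σ →
    (d : Fin n) → Green.RegularDClass _·_ d →
    (β : A → Set) →
    Labelling.LabelsIn _<_ _·_ σ β (λ a → Green._𝓓_ _·_ a d) →
    ∃ λ (N : ℕ) → (N ≤ Green.∣Dclass∣ _·_ d) ×
      Σ ((x : A) → β x → Fin N) λ s →
        Labelling.Ramseyan _<_ _·_ β s σ
lemma4 em n _·_ isSemigroup A _<_ sto _ σ additive d reg β σ∈𝓓 with em {∃ β}
... | no ∄x = 0 , z≤n , (λ x x∈β → ⊥-elim (∄x (x , x∈β))) , λ ()
... | yes (x0 , x0∈β) = _ , ≤-refl , split , ramseyan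
  where
  open RamseyanSplit em isSemigroup sto additive reg σ∈𝓓
  open Split x0∈β (proj₂ (anchor x0∈β))
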